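{- Let $r\le r'\le n$, let $S\subseteq[n]$ and $s\in[n]\setminus S$. Let \[\mathscr B=\Big\{(p_I)\in\mathbb T^{\binom nr}\times\mathbb T^{\binom n{r'}}:\ p_I=\infty\text{ for every }I\in\tbinom{[n]}r\text{ with }s\in I\Big\}.\] Then $\operatorname{LFlDr}(r,r',S;n)\cap\mathscr B\subseteq\operatorname{LFlDr}(r,r',S\cup\{s\};n)$.
   Context: $\mathbb T=\mathbb R\cup\{\infty\}$ with $\oplus=\min$, $\odot=+$; $\mathbb P(\mathbb T^N)=(\mathbb T^N\setminus\{(\infty,\dots,\infty)\})/\mathbb R\mathbf 1$ (membership in $\mathscr B$ is invariant under the quotient). For a tropical polynomial $F=\bigoplus_uc_u\odot x^u$, $V(F)$ is the set of points where $\min_u\{c_u+\sum u_ix_i\}$ is attained at least twice or equals $\infty$. For $T\subseteq[n]$, $\operatorname{LFlDr}(r,r',T;n)\subseteq\mathbb P(\mathbb T^{\binom nr})\times\mathbb P(\mathbb T^{\binom n{r'}})$ is the intersection of the tropical hypersurfaces of: the tropical Grassmann–Plücker polynomials $\bigoplus_{j\in J\setminus I}p_{I\cup j}\odot p_{J\setminus j}$ ($I\in\binom{[n]}{a-1}$, $J\in\binom{[n]}{a+1}$) for $a=r$ and $a=r'$, and the polynomials $\bigoplus_{j\in J\setminus(I\cup T)}p_{I\cup j}\odot p_{J\setminus j}$ for $I\in\binom{[n]}{r-1}$, $J\in\binom{[n]}{r'+1}$. -}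

module Defs where

open import Level using (0ℓ)
open import Data.Nat using (ℕ; suc; _+_)
open import Data.Bool using (Bool; true; false; _∧_; not)
open import Data.Fin using (Fin)
open import Data.Fin.Subset using (Subset; ⁅_⁆; _∪_; _-_; ∣_∣)
open import Data.Vec using (lookup)
open import Data.List using (List; []; _∷_; map; filterᵇ; length; allFin)
import Data.List as L
open import Data.Maybe using (Maybe; just; nothing)
open import Data.Product using (Σ; _×_; _,_; ∃; ∃-syntax)
open import Data.Sum using (_⊎_)
open import Data.Unit using (⊤)
open import Data.Empty using (⊥)
open import Relation.Nullary using (¬_)
open import Relation.Binary.PropositionalEquality using (_≡_)
open import Relation.Binary.Structures using (IsTotalOrder)

-- A linearly ordered abelian group (ℝ with + and ≤ is the instance used in the paper).
record OrderedAbelianGroup : Set₁ where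
  field
    Carrier : Set
    _+ᴳ_    : Carrier → Carrier → Carrier
    0ᴳ      : Carrier
    -ᴳ_     : Carrier → Carrier
    _≤ᴳ_    : Carrier → Carrier → Set
    isTotalOrder : IsTotalOrder _≡_ _≤ᴳ_
    +-assoc : ∀ x y z → (x +ᴳ y) +ᴳ z ≡ x +ᴳ (y +ᴳ z)
    +-comm  : ∀ x y → x +ᴳ y ≡ y +ᴳ x
    +-identityˡ : ∀ x → 0ᴳ +ᴳ x ≡ x
    -‿inverseˡ : ∀ x → (-ᴳ x) +ᴳ x ≡ 0ᴳ
    +-monoˡ-≤ : ∀ z {x y} → x ≤ᴳ y → (x +ᴳ z) ≤ᴳ (y +ᴳ z)

module _ (G : OrderedAbelianGroup) where
  open OrderedAbelianGroup G

  -- Tropical numbers 𝕋 = G ∪ {∞}; nothing = ∞.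
  Trop : Set
  Trop = Maybe Carrier

  _⊙_ : Trop → Trop → Trop
  just x ⊙ just y = just (x +ᴳ y)
  _ ⊙ _ = nothing

  _≤T_ : Trop → Trop → Set
  _ ≤T nothing = ⊤
  nothing ≤T just _ = ⊥
  just x ≤T just y = x ≤ᴳ y

  -- A tropical polynomial evaluated at a point is given by the list of values
  -- of its terms c_u ⊙ x^u.
  TropVanishes : List Trop → Set
  TropVanishes ts =
    (∀ (i : Fin (length ts)) → L.lookup ts i ≡ nothing)
    ⊎ (∃[ i ] ∃[ j ] (¬ i ≡ j × L.lookup ts i ≡ L.lookup ts j
         × (∀ k → L.lookup ts i ≤T L.lookup ts k)))


  -- coordinates indexed by subsets of [n]; only subsets of the relevant size matter
  Coords : ℕ → Set
  Coords n = Subset n → Trop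

  pluckerTerms : ∀ {n} → Coords n → Coords n → Subset n → Subset n → Subset n → List Trop
  pluckerTerms {n} p q T I J =
    map (λ j → p (I ∪ ⁅ j ⁆) ⊙ q (J - j))
        (filterᵇ (λ j → lookup J j ∧ not (lookup I j) ∧ not (lookup T j)) (allFin n))

  ∅ˢ : ∀ {n} → Subset n
  ∅ˢ = Data.Fin.Subset.⊥

  -- p represents a point of ℙ(𝕋^{binom n a}): not all coordinates ∞
  NotAllInfinite : ∀ {n} → ℕ → Coords n → Set
  NotAllInfinite {n} a p = ∃[ I ] (∣ I ∣ ≡ a × ¬ p I ≡ nothing)

  LFlDr : (r r' : ℕ) {n : ℕ} → Subset n → Coords n × Coords n → Set
  LFlDr r r' {n} T (p , q) =
    NotAllInfinite r p × NotAllInfinite r' q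
    × (∀ (I J : Subset n) → suc ∣ I ∣ ≡ r → ∣ J ∣ ≡ suc r →
         TropVanishes (pluckerTerms p p ∅ˢ I J))
    × (∀ (I J : Subset n) → suc ∣ I ∣ ≡ r' → ∣ J ∣ ≡ suc r' →
         TropVanishes (pluckerTerms q q ∅ˢ I J))
    × (∀ (I J : Subset n) → suc ∣ I ∣ ≡ r → ∣ J ∣ ≡ suc r' →
         TropVanishes (pluckerTerms p q T I J))

  InB : (r : ℕ) {n : ℕ} → Fin n → Coords n × Coords n → Set
  InB r {n} s (p , q) = ∀ (I : Subset n) → ∣ I ∣ ≡ r → lookup I s ≡ true → p I ≡ nothing

-- Passing from S to S ∪ {s} only deletes, from each incidence relation, the term
-- p_{I ∪ s} ⊙ q_{J ∖ s}. Since I ∪ s is an r-subset containing s, that term is ∞ on 𝓑,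
-- and deleting ∞ terms from a tropical polynomial does not change whether its minimum
-- is ∞ or attained twice.
module Submission where

open import Defs
open import Data.Nat using (ℕ; suc; _≤_)
open import Data.Bool using (Bool; true; false; _∧_; not)
open import Data.Bool.Properties using (∨-identityʳ)
open import Data.Fin using (Fin; zero; suc; _≟_)
open import Data.Fin.Subset using (Subset; ⁅_⁆; _∪_; _-_; ∣_∣)
open import Data.Fin.Subset.Properties using (x∈⁅x⁆; x∈p∪q⁺; ∪-identityʳ)
open import Data.Vec using (_∷_; lookup)
open import Data.Vec.Properties using ([]=⇒lookup)
open import Data.List using (List; []; _∷_; map; filterᵇ; length; allFin)
import Data.List as List
open import Data.Maybe using (just; nothing)
open import Data.Product using (_×_; _,_; ∃-syntax)
open import Data.Sum using (inj₁; inj₂)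
open import Function using (_∘_)
open import Relation.Nullary using (¬_; Dec; yes; no; contradiction)
open import Relation.Binary.PropositionalEquality
  using (_≡_; _≢_; refl; sym; trans; cong; subst₂)

lookup-∪⁅x⁆-x : ∀ {n} (p : Subset n) (x : Fin n) → lookup (p ∪ ⁅ x ⁆) x ≡ true
lookup-∪⁅x⁆-x p x = []=⇒lookup (x∈p∪q⁺ {p = p} (inj₂ (x∈⁅x⁆ x)))

lookup-∪⁅y⁆-x : ∀ {n} (p : Subset n) {x y : Fin n} → x ≢ y → lookup (p ∪ ⁅ y ⁆) x ≡ lookup p x
lookup-∪⁅y⁆-x (b ∷ p) {zero}  {zero}  x≢y = contradiction refl x≢y
lookup-∪⁅y⁆-x (b ∷ p) {zero}  {suc y} x≢y = ∨-identityʳ b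
lookup-∪⁅y⁆-x (b ∷ p) {suc x} {zero}  x≢y = cong (λ p′ → lookup p′ x) (∪-identityʳ p)
lookup-∪⁅y⁆-x (b ∷ p) {suc x} {suc y} x≢y = lookup-∪⁅y⁆-x p (x≢y ∘ cong suc)

∣p∪⁅x⁆∣≡1+∣p∣ : ∀ {n} (p : Subset n) (x : Fin n) → lookup p x ≡ false → ∣ p ∪ ⁅ x ⁆ ∣ ≡ suc ∣ p ∣
∣p∪⁅x⁆∣≡1+∣p∣ (false ∷ p) zero    x∉p = cong (suc ∘ ∣_∣) (∪-identityʳ p)
∣p∪⁅x⁆∣≡1+∣p∣ (false ∷ p) (suc x) x∉p = ∣p∪⁅x⁆∣≡1+∣p∣ p x x∉p
∣p∪⁅x⁆∣≡1+∣p∣ (true  ∷ p) (suc x) x∉p = cong suc (∣p∪⁅x⁆∣≡1+∣p∣ p x x∉p)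

module _ (G : OrderedAbelianGroup) where

  ∞? : (t : Trop G) → Dec (t ≡ nothing)
  ∞? nothing  = yes refl
  ∞? (just _) = no λ ()

  ∞≤T⇒∞ : ∀ {s t} → s ≡ nothing → _≤T_ G s t → t ≡ nothing
  ∞≤T⇒∞ {t = nothing} refl _ = refl

  data Drop∞ : List (Trop G) → List (Trop G) → Set where
    []    : Drop∞ [] []
    keep  : ∀ {x xs ys} → Drop∞ xs ys → Drop∞ (x ∷ xs) (x ∷ ys)
    drop∞ : ∀ {x xs ys} → x ≡ nothing → Drop∞ xs ys → Drop∞ (x ∷ xs) ys

  embed : ∀ {xs ys} → Drop∞ xs ys → Fin (length ys) → Fin (length xs)
  embed (keep d)    zero    = zero
  embed (keep d)    (suc k) = suc (embed d k)
  embed (drop∞ _ d) k       = suc (embed d k)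

  lookup-embed : ∀ {xs ys} (d : Drop∞ xs ys) k → List.lookup ys k ≡ List.lookup xs (embed d k)
  lookup-embed (keep d)    zero    = refl
  lookup-embed (keep d)    (suc k) = lookup-embed d k
  lookup-embed (drop∞ _ d) k       = lookup-embed d k

  finite⇒∈-image-embed : ∀ {xs ys} (d : Drop∞ xs ys) i →
    ¬ List.lookup xs i ≡ nothing → ∃[ k ] embed d k ≡ i
  finite⇒∈-image-embed (keep d)      zero    _    = zero , refl
  finite⇒∈-image-embed (keep d)      (suc i) xᵢ<∞ with finite⇒∈-image-embed d i xᵢ<∞
  ... | k , refl = suc k , refl
  finite⇒∈-image-embed (drop∞ x∞ d)  zero    x<∞  = contradiction x∞ x<∞
  finite⇒∈-image-embed (drop∞ _ d)   (suc i) xᵢ<∞ with finite⇒∈-image-embed d i xᵢ<∞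
  ... | k , refl = k , refl

  -- An attained minimum ∞ forces every entry to be ∞; a finite minimum lives on
  -- entries that survive the deletion.
  Drop∞-TropVanishes : ∀ {xs ys} → Drop∞ xs ys → TropVanishes G xs → TropVanishes G ys
  Drop∞-TropVanishes d (inj₁ all∞) = inj₁ λ k → trans (lookup-embed d k) (all∞ (embed d k))
  Drop∞-TropVanishes {xs} d (inj₂ (i , j , i≢j , tie , minimal)) with ∞? (List.lookup xs i)
  ... | yes xᵢ∞ = inj₁ λ k → trans (lookup-embed d k) (∞≤T⇒∞ xᵢ∞ (minimal (embed d k)))
  ... | no xᵢ<∞
    with finite⇒∈-image-embed d i xᵢ<∞ | finite⇒∈-image-embed d j (xᵢ<∞ ∘ trans tie)
  ... | kᵢ , refl | kⱼ , refl =
    inj₂ ( kᵢ , kⱼ , i≢j ∘ cong (embed d)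
         , trans (lookup-embed d kᵢ) (trans tie (sym (lookup-embed d kⱼ)))
         , λ k → subst₂ (_≤T_ G) (sym (lookup-embed d kᵢ)) (sym (lookup-embed d k))
                        (minimal (embed d k)) )

  filterᵇ-Drop∞ : ∀ {A : Set} (g : A → Trop G) (P Q : A → Bool) →
    (∀ x → Q x ≡ true → P x ≡ true) →
    (∀ x → P x ≡ true → Q x ≡ false → g x ≡ nothing) →
    ∀ xs → Drop∞ (map g (filterᵇ P xs)) (map g (filterᵇ Q xs))
  filterᵇ-Drop∞ g P Q Q⊆P g∞ [] = []
  filterᵇ-Drop∞ g P Q Q⊆P g∞ (x ∷ xs) with P x in Px | Q x in Qx
  ... | true  | true  = keep (filterᵇ-Drop∞ g P Q Q⊆P g∞ xs)
  ... | true  | false = drop∞ (g∞ x Px Qx) (filterᵇ-Drop∞ g P Q Q⊆P g∞ xs)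
  ... | false | true  = contradiction (trans (sym (Q⊆P x Qx)) Px) λ ()
  ... | false | false = filterᵇ-Drop∞ g P Q Q⊆P g∞ xs

  -- No assumption s ∉ S is needed: if s ∈ S then S ∪ ⁅ s ⁆ = S anyway.
  incidence-∪⁅s⁆ : ∀ (r : ℕ) {n} (S : Subset n) (s : Fin n) (p q : Coords G n) →
    InB G r s (p , q) → ∀ (I J : Subset n) → suc ∣ I ∣ ≡ r →
    TropVanishes G (pluckerTerms G p q S I J) →
    TropVanishes G (pluckerTerms G p q (S ∪ ⁅ s ⁆) I J)
  incidence-∪⁅s⁆ r {n} S s p q p∈B I J 1+∣I∣≡r =
    Drop∞-TropVanishes
      (filterᵇ-Drop∞ term (candidate S) (candidate (S ∪ ⁅ s ⁆)) candidate-∪⁅s⁆⇒candidate term∞ (allFin n))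
    where
    candidate : Subset n → Fin n → Bool
    candidate T j = lookup J j ∧ not (lookup I j) ∧ not (lookup T j)

    term : Fin n → Trop G
    term j = _⊙_ G (p (I ∪ ⁅ j ⁆)) (q (J - j))

    candidate⇒∉I : ∀ T j → candidate T j ≡ true → lookup I j ≡ false
    candidate⇒∉I T j c with lookup J j | lookup I j
    ... | true  | false = refl
    ... | true  | true  = contradiction c λ ()
    ... | false | _     = contradiction c λ ()

    ∈T⇒¬candidate : ∀ T j → lookup T j ≡ true → candidate T j ≡ false
    ∈T⇒¬candidate T j j∈T with lookup J j | lookup I j
    ... | false | _     = refl
    ... | true  | true  = refl
    ... | true  | false = cong not j∈T

    candidate-∪⁅s⁆ : ∀ {j} → j ≢ s → candidate (S ∪ ⁅ s ⁆) j ≡ candidate S j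
    candidate-∪⁅s⁆ {j} j≢s =
      cong (λ b → lookup J j ∧ not (lookup I j) ∧ not b) (lookup-∪⁅y⁆-x S j≢s)

    candidate-∪⁅s⁆⇒candidate : ∀ j → candidate (S ∪ ⁅ s ⁆) j ≡ true → candidate S j ≡ true
    candidate-∪⁅s⁆⇒candidate j c with j ≟ s
    ... | yes refl = contradiction (trans (sym c) (∈T⇒¬candidate (S ∪ ⁅ s ⁆) j (lookup-∪⁅x⁆-x S j))) λ ()
    ... | no j≢s   = trans (sym (candidate-∪⁅s⁆ j≢s)) c

    term∞ : ∀ j → candidate S j ≡ true → candidate (S ∪ ⁅ s ⁆) j ≡ false → term j ≡ nothing
    term∞ j c ¬c with j ≟ s
    ... | yes refl = cong (λ t → _⊙_ G t (q (J - j)))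
                          (p∈B (I ∪ ⁅ j ⁆) (trans (∣p∪⁅x⁆∣≡1+∣p∣ I j (candidate⇒∉I S j c)) 1+∣I∣≡r)
                               (lookup-∪⁅x⁆-x I j))
    ... | no j≢s   = contradiction (trans (sym c) (trans (sym (candidate-∪⁅s⁆ j≢s)) ¬c)) λ ()

corollary4p8 : (G : OrderedAbelianGroup) (r r' n : ℕ) → r ≤ r' → r' ≤ n →
    (S : Subset n) (s : Fin n) → lookup S s ≡ false →
    (x : Coords G n × Coords G n) →
    LFlDr G r r' S x → InB G r s x → LFlDr G r r' (S ∪ ⁅ s ⁆) x
corollary4p8 G r r' n _ _ S s _ (p , q) (p≢∞ , q≢∞ , plücker-p , plücker-q , incidence) p∈B =
  p≢∞ , q≢∞ , plücker-p , plücker-q ,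
  λ I J 1+∣I∣≡r ∣J∣≡1+r' → incidence-∪⁅s⁆ G r S s p q p∈B I J 1+∣I∣≡r (incidence I J 1+∣I∣≡r ∣J∣≡1+r')
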